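{- Let $n\ge1$ and let $\mathcal K$ be a finite set of graphs. Then there is a graph $F_{\mathcal K}$ such that for all graphs $G$ and $H$ with exactly $n$ vertices, $\hom(F_{\mathcal K},G)=\hom(F_{\mathcal K},H)$ if and only if at least one of the following holds: (a) there exist $F,F'\in\mathcal K$ with $\hom(F,G)=0$ and $\hom(F',H)=0$; (b) $\hom(F,G)=\hom(F,H)$ for all $F\in\mathcal K$.
   Context: Graphs are finite, simple, undirected, with non-empty vertex set. $\hom(F,G)$ is the number of homomorphisms from $F$ to $G$. -}

module Defs where

open import Data.Nat using (ℕ; zero; suc; _+_; NonZero)
open import Data.Bool using (Bool; true; false; _∧_; if_then_else_)
open import Data.Fin using (Fin; zero; suc)
open import Data.List using (List; []; _∷_; map; concatMap; length; filter; allFin)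
open import Data.List.Relation.Unary.All as All using (All)
open import Relation.Binary.PropositionalEquality using (_≡_)
open import Relation.Nullary using (Dec; yes; no)

-- A finite simple undirected graph with a non-empty vertex set:
-- vertices are Fin (suc m) (so at least one vertex), adjacency is a
-- Bool-valued relation that is symmetric and irreflexive.
record Graph : Set where
  field
    m     : ℕ
    adj   : Fin (suc m) → Fin (suc m) → Bool
    sym   : ∀ u v → adj u v ≡ adj v u
    irrefl : ∀ v → adj v v ≡ false

open Graph public

∣V∣ : Graph → ℕ
∣V∣ G = suc (m G)

allFuns : (a b : ℕ) → List (Fin a → Fin b)
allFuns zero    b = (λ ()) ∷ []
allFuns (suc a) b =
  concatMap (λ (y : Fin b) →
    map (λ (f : Fin a → Fin b) → λ { zero → y ; (suc i) → f i }) (allFuns a b))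
    (allFin b)

andL : List Bool → Bool
andL []       = true
andL (x ∷ xs) = x ∧ andL xs

isHom? : (F G : Graph) → (Fin (∣V∣ F) → Fin (∣V∣ G)) → Bool
isHom? F G f =
  andL (concatMap (λ u → map (λ v →
     if adj F u v then adj G (f u) (f v) else true) (allFin (∣V∣ F)))
     (allFin (∣V∣ F)))

hom : Graph → Graph → ℕ
hom F G = length (filter (λ f → isHomDec (isHom? F G f)) (allFuns (∣V∣ F) (∣V∣ G)))
  where
  isHomDec : (b : Bool) → Dec (b ≡ true)
  isHomDec true  = yes _≡_.refl
  isHomDec false = no (λ ())

-- The graph F_K is K₁ together with, for each F ∈ K, many disjoint copies of F.
-- Since hom(−, G) turns disjoint unions into products and hom(K₁, G) = n,
-- hom(F_K, G) = n · ∏_F hom(F, G)^(e_F + 1), which vanishes exactly when some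
-- hom(F, G) does. The exponents grow so fast along K that, when nothing vanishes,
-- the first F with hom(F, G) < hom(F, H) makes its factor outweigh everything
-- after it: by Bernoulli's inequality h^(e+1) · n^|R| < (h + 1)^(e+1) once
-- e ≥ h · n^|R|, and all the homomorphism counts involved are bounded by n^|·|.
-- So equal values of hom(F_K, −) on non-vanishing G, H force equal hom(F, −).

module Submission where

open import Data.Bool using (Bool; true; false; T; _∧_; if_then_else_)
open import Data.Bool.Properties using (T-∧)
open import Data.Fin using (Fin; zero; suc; _↑ˡ_; _↑ʳ_; splitAt)
open import Data.Fin.Properties using (splitAt-↑ˡ; splitAt-↑ʳ; splitAt⁻¹-↑ˡ; splitAt⁻¹-↑ʳ)
open import Data.List using (List; []; _∷_; _++_; map; concatMap; length; allFin; filter; foldr)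
open import Data.List.Properties using (map-cong; length-tabulate)
open import Data.List.Relation.Unary.All using (All; []; _∷_)
open import Data.List.Relation.Unary.All.Properties using (map⁺; map⁻; concat⁺; concat⁻; tabulate⁺; tabulate⁻)
open import Data.List.Relation.Unary.Any using (Any; here; there)
open import Data.Nat using (ℕ; zero; suc; _+_; _*_; _^_; _≤_; _<_; _≥_; z≤n; s≤s; NonZero; ≢-nonZero; _≟_)
open import Data.Nat.ListAction using (sum)
open import Data.Nat.Properties
  using ( +-comm; +-suc; +-identityʳ; +-monoˡ-≤; *-comm; *-assoc; *-suc; *-identityʳ; *-zeroʳ
        ; *-distribʳ-+; *-monoˡ-≤; *-monoʳ-≤; *-monoʳ-<; *-cancelˡ-≡; ^-monoˡ-≤
        ; ≤-refl; ≤-reflexive; ≤-trans; m≤m+n; m≤n+m; m≤m*n; m≤n⇒m≤1+n; <-cmp; <⇒≢; >⇒≢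
        ; m*n≡0⇒m≡0∨n≡0; m^n≡0⇒m≡0; m*n≢0⇒m≢0; m*n≢0⇒n≢0; m^n≢0
        ; *-commutativeSemigroup; module ≤-Reasoning )
open import Algebra.Properties.CommutativeSemigroup *-commutativeSemigroup using (x∙yz≈y∙xz)
open import Data.Product using (Σ; _×_; _,_; proj₁; proj₂)
open import Data.Product.Function.NonDependent.Propositional using (_×-⇔_)
open import Data.Sum using (_⊎_; inj₁; inj₂; [_,_]′; map₁)
open import Data.Unit using (tt)
open import Data.Vec.Functional using (take; drop) renaming (_∷_ to _◂_)
open import Function using (_∘_; id)
open import Function.Bundles using (_⇔_; mk⇔; Equivalence)
open import Function.Properties.Equivalence using () renaming (trans to ⇔-trans; sym to ⇔-sym)
open import Relation.Binary.Core using (_Preserves_⟶_)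
open import Relation.Binary.Definitions using (tri<; tri≈; tri>)
open import Relation.Binary.PropositionalEquality
open import Relation.Nullary using (yes; no; contradiction)
open import Relation.Unary using (Decidable)

open import Defs hiding (sym)

private variable
  A B : Set

count : (A → Bool) → List A → ℕ
count p []       = 0
count p (x ∷ xs) = if p x then suc (count p xs) else count p xs

length-filter≡count : ∀ (p : A → Bool) (P? : Decidable (λ x → p x ≡ true)) xs →
                      length (filter P? xs) ≡ count p xs
length-filter≡count p P? [] = refl
length-filter≡count p P? (x ∷ xs) with p x | P? x
... | true  | yes _  = cong suc (length-filter≡count p P? xs)
... | true  | no ¬t  = contradiction refl ¬t
... | false | no _   = length-filter≡count p P? xs

count-++ : ∀ (p : A → Bool) xs ys → count p (xs ++ ys) ≡ count p xs + count p ys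
count-++ p []       ys = refl
count-++ p (x ∷ xs) ys with p x
... | true  = cong suc (count-++ p xs ys)
... | false = count-++ p xs ys

count-concatMap : ∀ (p : A → Bool) (f : B → List A) xs →
                  count p (concatMap f xs) ≡ sum (map (count p ∘ f) xs)
count-concatMap p f []       = refl
count-concatMap p f (x ∷ xs) =
  trans (count-++ p (f x) (concatMap f xs)) (cong (count p (f x) +_) (count-concatMap p f xs))

count-map : ∀ (p : B → Bool) (f : A → B) xs → count p (map f xs) ≡ count (p ∘ f) xs
count-map p f []       = refl
count-map p f (x ∷ xs) with p (f x)
... | true  = cong suc (count-map p f xs)
... | false = count-map p f xs

count-cong : ∀ {p q : A → Bool} → (∀ x → p x ≡ q x) → ∀ xs → count p xs ≡ count q xs
count-cong p≗q []       = refl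
count-cong p≗q (x ∷ xs) rewrite p≗q x | count-cong p≗q xs = refl

count≤count-true : ∀ (p : A → Bool) xs → count p xs ≤ count (λ _ → true) xs
count≤count-true p []       = z≤n
count≤count-true p (x ∷ xs) with p x
... | true  = s≤s (count≤count-true p xs)
... | false = m≤n⇒m≤1+n (count≤count-true p xs)

count-false : ∀ (xs : List A) → count (λ _ → false) xs ≡ 0
count-false []       = refl
count-false (x ∷ xs) = count-false xs

count-∧ˡ : ∀ t (q : A → Bool) xs → count (λ x → t ∧ q x) xs ≡ (if t then 1 else 0) * count q xs
count-∧ˡ true  q xs = sym (+-identityʳ (count q xs))
count-∧ˡ false q xs = count-false xs

sum-map-*ʳ : ∀ (f : A → ℕ) k xs → sum (map (λ x → f x * k) xs) ≡ sum (map f xs) * k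
sum-map-*ʳ f k []       = refl
sum-map-*ʳ f k (x ∷ xs) =
  trans (cong (f x * k +_) (sum-map-*ʳ f k xs)) (sym (*-distribʳ-+ k (f x) (sum (map f xs))))

sum-map-const : ∀ c (xs : List A) → sum (map (λ _ → c) xs) ≡ length xs * c
sum-map-const c []       = refl
sum-map-const c (x ∷ xs) = cong (c +_) (sum-map-const c xs)

#Funs : ∀ a b → ((Fin a → Fin b) → Bool) → ℕ
#Funs a b p = count p (allFuns a b)

-- allFuns builds y ◂ f as a pattern lambda that agrees with y ◂ f only pointwise,
-- hence the hypothesis that p respects _≗_.
#Funs-suc : ∀ a b {p : (Fin (suc a) → Fin b) → Bool} → p Preserves _≗_ ⟶ _≡_ →
            #Funs (suc a) b p ≡ sum (map (λ y → #Funs a b (p ∘ (y ◂_))) (allFin b))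
#Funs-suc a b {p} p-cong =
  trans (count-concatMap p _ (allFin b)) (cong sum (map-cong count-fibre (allFin b)))
  where
  count-fibre : ∀ y → count p (map _ (allFuns a b)) ≡ #Funs a b (p ∘ (y ◂_))
  count-fibre y = trans (count-map p _ (allFuns a b))
    (count-cong (λ f → p-cong λ { zero → refl ; (suc i) → refl }) (allFuns a b))

#Funs-true : ∀ a b → #Funs a b (λ _ → true) ≡ b ^ a
#Funs-true zero    b = refl
#Funs-true (suc a) b = begin
  #Funs (suc a) b (λ _ → true)                         ≡⟨ #Funs-suc a b (λ _ → refl) ⟩
  sum (map (λ _ → #Funs a b (λ _ → true)) (allFin b))  ≡⟨ sum-map-const _ (allFin b) ⟩
  length (allFin b) * #Funs a b (λ _ → true)           ≡⟨ cong₂ _*_ (length-tabulate {n = b} id) (#Funs-true a b) ⟩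
  b * b ^ a                                            ∎
  where open ≡-Reasoning

◂-cong : ∀ {a b} (y : Fin b) {f g : Fin a → Fin b} → f ≗ g → (y ◂ f) ≗ (y ◂ g)
◂-cong y f≗g zero    = refl
◂-cong y f≗g (suc i) = f≗g i

#Funs-take-drop : ∀ a c b {p : (Fin a → Fin b) → Bool} {q : (Fin c → Fin b) → Bool} →
                  p Preserves _≗_ ⟶ _≡_ → q Preserves _≗_ ⟶ _≡_ →
                  #Funs (a + c) b (λ f → p (take a f) ∧ q (drop a f)) ≡ #Funs a b p * #Funs c b q
#Funs-take-drop zero c b {q = q} p-cong q-cong =
  trans (count-cong (λ f → cong (_∧ q f) (p-cong (λ ()))) (allFuns c b)) (count-∧ˡ _ q (allFuns c b))
#Funs-take-drop (suc a) c b {p} {q} p-cong q-cong = begin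
  #Funs (suc a + c) b split
    ≡⟨ #Funs-suc (a + c) b split-cong ⟩
  sum (map (λ y → #Funs (a + c) b (split ∘ (y ◂_))) (allFin b))
    ≡⟨ cong sum (map-cong split-fibre (allFin b)) ⟩
  sum (map (λ y → #Funs a b (p ∘ (y ◂_)) * #Funs c b q) (allFin b))
    ≡⟨ sum-map-*ʳ _ _ (allFin b) ⟩
  sum (map (λ y → #Funs a b (p ∘ (y ◂_))) (allFin b)) * #Funs c b q
    ≡⟨ cong (_* #Funs c b q) (#Funs-suc a b p-cong) ⟨
  #Funs (suc a) b p * #Funs c b q
    ∎
  where
  open ≡-Reasoning
  split : (Fin (suc a + c) → Fin b) → Bool
  split f = p (take (suc a) f) ∧ q (drop (suc a) f)
  split-cong : split Preserves _≗_ ⟶ _≡_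
  split-cong f≗g = cong₂ _∧_ (p-cong (f≗g ∘ (_↑ˡ c))) (q-cong (f≗g ∘ (suc a ↑ʳ_)))
  split-fibre : ∀ y → #Funs (a + c) b (split ∘ (y ◂_)) ≡ #Funs a b (p ∘ (y ◂_)) * #Funs c b q
  split-fibre y = trans
    (count-cong (λ f → cong (_∧ q (drop a f)) (p-cong λ { zero → refl ; (suc i) → refl })) (allFuns (a + c) b))
    (#Funs-take-drop a c b (p-cong ∘ ◂-cong y) q-cong)

T-injective : ∀ {x y} → T x ⇔ T y → x ≡ y
T-injective {false} {false} _   = refl
T-injective {false} {true}  x⇔y with () ← Equivalence.from x⇔y tt
T-injective {true}  {false} x⇔y with () ← Equivalence.to x⇔y tt
T-injective {true}  {true}  _   = refl

T-andL : ∀ xs → T (andL xs) ⇔ All T xs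
T-andL xs = mk⇔ (to xs) (from xs)
  where
  to : ∀ xs → T (andL xs) → All T xs
  to []           _ = []
  to (true ∷ xs)  t = tt ∷ to xs t
  from : ∀ xs → All T xs → T (andL xs)
  from []          []       = tt
  from (true ∷ xs) (_ ∷ ts) = from xs ts

T-if-then-true : ∀ x y → T (if x then y else true) ⇔ (T x → T y)
T-if-then-true true  y = mk⇔ (λ t _ → t) (λ f → f tt)
T-if-then-true false y = mk⇔ (λ _ ()) (λ _ → tt)

All-allFin : ∀ {n} {P : Fin n → Set} → All P (allFin n) ⇔ (∀ i → P i)
All-allFin = mk⇔ (tabulate⁻ {f = id}) (tabulate⁺ {f = id})

T-andL-grid : ∀ {n} (g : Fin n → Fin n → Bool) →
              T (andL (concatMap (λ u → map (g u) (allFin n)) (allFin n))) ⇔ (∀ u v → T (g u v))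
T-andL-grid g = mk⇔
  (λ t u v → Equivalence.to All-allFin
     (map⁻ (Equivalence.to All-allFin (map⁻ (concat⁻ (Equivalence.to (T-andL _) t))) u)) v)
  (λ h → Equivalence.from (T-andL _)
     (concat⁺ (map⁺ (Equivalence.from All-allFin λ u → map⁺ (Equivalence.from All-allFin (h u))))))

IsHom : (F G : Graph) → (Fin (∣V∣ F) → Fin (∣V∣ G)) → Set
IsHom F G f = ∀ u v → T (adj F u v) → T (adj G (f u) (f v))

isHom?-correct : ∀ F G f → T (isHom? F G f) ⇔ IsHom F G f
isHom?-correct F G f = mk⇔
  (λ t u v → Equivalence.to (T-if-then-true (adj F u v) _) (Equivalence.to (T-andL-grid edgeOK) t u v))
  (λ h → Equivalence.from (T-andL-grid edgeOK) λ u v → Equivalence.from (T-if-then-true (adj F u v) _) (h u v))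
  where
  edgeOK : Fin (∣V∣ F) → Fin (∣V∣ F) → Bool
  edgeOK u v = if adj F u v then adj G (f u) (f v) else true

IsHom-cong : ∀ F G {f g} → f ≗ g → IsHom F G f → IsHom F G g
IsHom-cong F G f≗g h u v a = subst₂ (λ x y → T (adj G x y)) (f≗g u) (f≗g v) (h u v a)

isHom?-cong : ∀ F G → isHom? F G Preserves _≗_ ⟶ _≡_
isHom?-cong F G f≗g = T-injective (mk⇔
  (Equivalence.from (isHom?-correct F G _) ∘ IsHom-cong F G f≗g ∘ Equivalence.to (isHom?-correct F G _))
  (Equivalence.from (isHom?-correct F G _) ∘ IsHom-cong F G (sym ∘ f≗g) ∘ Equivalence.to (isHom?-correct F G _)))

hom≡#Funs : ∀ F G → hom F G ≡ #Funs (∣V∣ F) (∣V∣ G) (isHom? F G)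
hom≡#Funs F G = length-filter≡count (isHom? F G) _ (allFuns (∣V∣ F) (∣V∣ G))

hom-≤ : ∀ F G {n} → ∣V∣ G ≡ n → hom F G ≤ n ^ ∣V∣ F
hom-≤ F G refl = begin
  hom F G                                       ≡⟨ hom≡#Funs F G ⟩
  #Funs (∣V∣ F) (∣V∣ G) (isHom? F G)            ≤⟨ count≤count-true (isHom? F G) (allFuns (∣V∣ F) (∣V∣ G)) ⟩
  #Funs (∣V∣ F) (∣V∣ G) (λ _ → true)            ≡⟨ #Funs-true (∣V∣ F) (∣V∣ G) ⟩
  ∣V∣ G ^ ∣V∣ F                                 ∎
  where open ≤-Reasoning

K₁ : Graph
K₁ = record { m = 0 ; adj = λ _ _ → false ; sym = λ _ _ → refl ; irrefl = λ _ → refl }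

hom-K₁ : ∀ G → hom K₁ G ≡ ∣V∣ G
hom-K₁ G = trans (hom≡#Funs K₁ G) (trans (#Funs-true 1 (∣V∣ G)) (*-identityʳ (∣V∣ G)))

module _ (F F′ : Graph) where

  adj-⊎ : Fin (∣V∣ F) ⊎ Fin (∣V∣ F′) → Fin (∣V∣ F) ⊎ Fin (∣V∣ F′) → Bool
  adj-⊎ (inj₁ u) (inj₁ v) = adj F u v
  adj-⊎ (inj₂ u) (inj₂ v) = adj F′ u v
  adj-⊎ _        _        = false

  adj-⊎-sym : ∀ u v → adj-⊎ u v ≡ adj-⊎ v u
  adj-⊎-sym (inj₁ u) (inj₁ v) = Graph.sym F u v
  adj-⊎-sym (inj₁ u) (inj₂ v) = refl
  adj-⊎-sym (inj₂ u) (inj₁ v) = refl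
  adj-⊎-sym (inj₂ u) (inj₂ v) = Graph.sym F′ u v

  adj-⊎-irrefl : ∀ v → adj-⊎ v v ≡ false
  adj-⊎-irrefl (inj₁ v) = irrefl F v
  adj-⊎-irrefl (inj₂ v) = irrefl F′ v

  _⊎ᴳ_ : Graph
  _⊎ᴳ_ = record
    { m      = m F + ∣V∣ F′
    ; adj    = λ u v → adj-⊎ (splitAt (∣V∣ F) u) (splitAt (∣V∣ F) v)
    ; sym    = λ u v → adj-⊎-sym (splitAt (∣V∣ F) u) (splitAt (∣V∣ F) v)
    ; irrefl = λ v → adj-⊎-irrefl (splitAt (∣V∣ F) v)
    }

module _ (F F′ G : Graph) where

  IsHom-⊎ᴳ : ∀ f → IsHom (F ⊎ᴳ F′) G f ⇔ (IsHom F G (take (∣V∣ F) f) × IsHom F′ G (drop (∣V∣ F) f))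
  IsHom-⊎ᴳ f = mk⇔ (λ h → restrictˡ h , restrictʳ h) (λ (h₁ , h₂) → glue h₁ h₂)
    where
    p q : ℕ
    p = ∣V∣ F
    q = ∣V∣ F′
    restrictˡ : IsHom (F ⊎ᴳ F′) G f → IsHom F G (take p f)
    restrictˡ h u v a = h _ _ (subst T (sym (cong₂ (adj-⊎ F F′) (splitAt-↑ˡ p u q) (splitAt-↑ˡ p v q))) a)
    restrictʳ : IsHom (F ⊎ᴳ F′) G f → IsHom F′ G (drop p f)
    restrictʳ h u v a = h _ _ (subst T (sym (cong₂ (adj-⊎ F F′) (splitAt-↑ʳ p q u) (splitAt-↑ʳ p q v))) a)
    edge-at : ∀ {u u′ v v′} → u ≡ u′ → v ≡ v′ → T (adj G (f u) (f v)) → T (adj G (f u′) (f v′))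
    edge-at = subst₂ (λ x y → T (adj G (f x) (f y)))
    glue : IsHom F G (take p f) → IsHom F′ G (drop p f) → IsHom (F ⊎ᴳ F′) G f
    glue h₁ h₂ u v a with splitAt p u in eu | splitAt p v in ev
    ... | inj₁ i | inj₁ j = edge-at (splitAt⁻¹-↑ˡ eu) (splitAt⁻¹-↑ˡ ev) (h₁ i j a)
    ... | inj₂ i | inj₂ j = edge-at (splitAt⁻¹-↑ʳ eu) (splitAt⁻¹-↑ʳ ev) (h₂ i j a)

  isHom?-⊎ᴳ : ∀ f →
              isHom? (F ⊎ᴳ F′) G f ≡ isHom? F G (take (∣V∣ F) f) ∧ isHom? F′ G (drop (∣V∣ F) f)
  isHom?-⊎ᴳ f = T-injective (⇔-trans (isHom?-correct (F ⊎ᴳ F′) G f) (⇔-trans (IsHom-⊎ᴳ f)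
    (⇔-sym (⇔-trans T-∧ (isHom?-correct F G _ ×-⇔ isHom?-correct F′ G _)))))

  hom-⊎ᴳ : hom (F ⊎ᴳ F′) G ≡ hom F G * hom F′ G
  hom-⊎ᴳ = begin
    hom (F ⊎ᴳ F′) G
      ≡⟨ hom≡#Funs (F ⊎ᴳ F′) G ⟩
    #Funs (∣V∣ F + ∣V∣ F′) (∣V∣ G) (isHom? (F ⊎ᴳ F′) G)
      ≡⟨ count-cong isHom?-⊎ᴳ (allFuns (∣V∣ F + ∣V∣ F′) (∣V∣ G)) ⟩
    #Funs (∣V∣ F + ∣V∣ F′) (∣V∣ G) (λ f → isHom? F G (take (∣V∣ F) f) ∧ isHom? F′ G (drop (∣V∣ F) f))
      ≡⟨ #Funs-take-drop (∣V∣ F) (∣V∣ F′) (∣V∣ G) (isHom?-cong F G) (isHom?-cong F′ G) ⟩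
    #Funs (∣V∣ F) (∣V∣ G) (isHom? F G) * #Funs (∣V∣ F′) (∣V∣ G) (isHom? F′ G)
      ≡⟨ cong₂ _*_ (hom≡#Funs F G) (hom≡#Funs F′ G) ⟨
    hom F G * hom F′ G
      ∎
    where open ≡-Reasoning

copies : ℕ → Graph → Graph
copies zero    F = F
copies (suc e) F = F ⊎ᴳ copies e F

hom-copies : ∀ e F G → hom (copies e F) G ≡ hom F G ^ suc e
hom-copies zero    F G = sym (*-identityʳ (hom F G))
hom-copies (suc e) F G = trans (hom-⊎ᴳ F (copies e F) G) (cong (hom F G *_) (hom-copies e F G))

bernoulli : ∀ h e → h ^ e * (h + suc e) ≤ suc h ^ suc e
bernoulli h zero    = ≤-reflexive (trans (+-identityʳ (h + 1)) (trans (+-comm h 1) (sym (*-identityʳ (suc h)))))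
bernoulli h (suc e) = begin
  h ^ suc e * (h + suc (suc e))   ≡⟨ *-assoc h (h ^ e) _ ⟩
  h * (h ^ e * (h + suc (suc e))) ≡⟨ x∙yz≈y∙xz h (h ^ e) _ ⟩
  h ^ e * (h * (h + suc (suc e))) ≤⟨ *-monoʳ-≤ (h ^ e) step ⟩
  h ^ e * (suc h * (h + suc e))   ≡⟨ x∙yz≈y∙xz (h ^ e) (suc h) _ ⟩
  suc h * (h ^ e * (h + suc e))   ≤⟨ *-monoʳ-≤ (suc h) (bernoulli h e) ⟩
  suc h * suc h ^ suc e           ∎
  where
  open ≤-Reasoning
  step : h * (h + suc (suc e)) ≤ suc h * (h + suc e)
  step = begin
    h * (h + suc (suc e))         ≡⟨ cong (h *_) (+-suc h (suc e)) ⟩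
    h * suc (h + suc e)           ≡⟨ *-suc h (h + suc e) ⟩
    h + h * (h + suc e)           ≤⟨ +-monoˡ-≤ (h * (h + suc e)) (m≤m+n h (suc e)) ⟩
    (h + suc e) + h * (h + suc e) ∎

^*-dominates : ∀ {B e} h k V W .{{_ : NonZero h}} .{{_ : NonZero W}} →
               h < k → V ≤ B → h * B ≤ e → h ^ suc e * V < k ^ suc e * W
^*-dominates {B} {e} h k V W h<k V≤B hB≤e = begin-strict
  h ^ suc e * V        ≤⟨ *-monoʳ-≤ (h ^ suc e) V≤B ⟩
  h * h ^ e * B        ≡⟨ trans (cong (_* B) (*-comm h (h ^ e))) (*-assoc (h ^ e) h B) ⟩
  h ^ e * (h * B)      <⟨ *-monoʳ-< (h ^ e) {{m^n≢0 h e}} (≤-trans (s≤s hB≤e) (m≤n+m (suc e) h)) ⟩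
  h ^ e * (h + suc e)  ≤⟨ bernoulli h e ⟩
  suc h ^ suc e        ≤⟨ ^-monoˡ-≤ (suc e) h<k ⟩
  k ^ suc e            ≤⟨ m≤m*n (k ^ suc e) W ⟩
  k ^ suc e * W        ∎
  where open ≤-Reasoning

^*-injective : ∀ {C B e} h k V W → h ≤ C → k ≤ C → V ≤ B → W ≤ B → C * B ≤ e →
               {{NonZero (h ^ suc e * V)}} → h ^ suc e * V ≡ k ^ suc e * W → h ≡ k × V ≡ W
^*-injective {C} {B} {e} h k V W h≤C k≤C V≤B W≤B CB≤e {{X≢0}} X≡Y with <-cmp h k
... | tri< h<k _ _ = contradiction X≡Y
  (<⇒≢ (^*-dominates h k V W {{h≢0}} {{W≢0}} h<k V≤B (≤-trans (*-monoˡ-≤ B h≤C) CB≤e)))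
  where
  h≢0 : NonZero h
  h≢0 = m*n≢0⇒m≢0 h {{m*n≢0⇒m≢0 (h ^ suc e)}}
  W≢0 : NonZero W
  W≢0 = m*n≢0⇒n≢0 (k ^ suc e) {{subst NonZero X≡Y X≢0}}
... | tri> _ _ k<h = contradiction X≡Y
  (>⇒≢ (^*-dominates k h W V {{k≢0}} {{V≢0}} k<h W≤B (≤-trans (*-monoˡ-≤ B k≤C) CB≤e)))
  where
  k≢0 : NonZero k
  k≢0 = m*n≢0⇒m≢0 k {{m*n≢0⇒m≢0 (k ^ suc e) {{subst NonZero X≡Y X≢0}}}}
  V≢0 : NonZero V
  V≢0 = m*n≢0⇒n≢0 (h ^ suc e)
... | tri≈ _ refl _ = refl , *-cancelˡ-≡ V W (h ^ suc e) {{m*n≢0⇒m≢0 (h ^ suc e)}} X≡Y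

exponent : ℕ → Graph → Graph → ℕ
exponent n F R = n ^ ∣V∣ F * n ^ ∣V∣ R

⊎ᴳ-dominant : ℕ → Graph → Graph → Graph
⊎ᴳ-dominant n F R = copies (exponent n F R) F ⊎ᴳ R

module _ (n : ℕ) (F R : Graph) where

  hom-⊎ᴳ-dominant : ∀ G → hom (⊎ᴳ-dominant n F R) G ≡ hom F G ^ suc (exponent n F R) * hom R G
  hom-⊎ᴳ-dominant G =
    trans (hom-⊎ᴳ (copies (exponent n F R) F) R G) (cong (_* hom R G) (hom-copies (exponent n F R) F G))

  ⊎ᴳ-dominant-≡0 : ∀ G → hom (⊎ᴳ-dominant n F R) G ≡ 0 ⇔ (hom F G ≡ 0 ⊎ hom R G ≡ 0)
  ⊎ᴳ-dominant-≡0 G = mk⇔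
    (map₁ (m^n≡0⇒m≡0 (hom F G) (suc e)) ∘ m*n≡0⇒m≡0∨n≡0 (hom F G ^ suc e)
       ∘ trans (sym (hom-⊎ᴳ-dominant G)))
    (trans (hom-⊎ᴳ-dominant G) ∘ [ cong (λ h → h ^ suc e * hom R G)
                                 , (λ hR≡0 → trans (cong (hom F G ^ suc e *_) hR≡0)
                                                   (*-zeroʳ (hom F G ^ suc e))) ]′)
    where
    e : ℕ
    e = exponent n F R

  ⊎ᴳ-dominant-injective : ∀ G H → ∣V∣ G ≡ n → ∣V∣ H ≡ n → hom (⊎ᴳ-dominant n F R) G ≢ 0 →
                         hom (⊎ᴳ-dominant n F R) G ≡ hom (⊎ᴳ-dominant n F R) H →
                         hom F G ≡ hom F H × hom R G ≡ hom R H
  ⊎ᴳ-dominant-injective G H ∣G∣ ∣H∣ X≢0 X≡Y =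
    ^*-injective (hom F G) (hom F H) (hom R G) (hom R H)
      (hom-≤ F G ∣G∣) (hom-≤ F H ∣H∣) (hom-≤ R G ∣G∣) (hom-≤ R H ∣H∣) ≤-refl
      {{≢-nonZero (X≢0 ∘ trans (hom-⊎ᴳ-dominant G))}}
      (trans (sym (hom-⊎ᴳ-dominant G)) (trans X≡Y (hom-⊎ᴳ-dominant H)))

separator : ℕ → List Graph → Graph
separator n = foldr (⊎ᴳ-dominant n) K₁

separator-≡0 : ∀ n K G → hom (separator n K) G ≡ 0 ⇔ Any (λ F → hom F G ≡ 0) K
separator-≡0 n []      G = mk⇔ (λ K₁≡0 → contradiction (trans (sym (hom-K₁ G)) K₁≡0) λ ()) λ ()
separator-≡0 n (F ∷ K) G = ⇔-trans (⊎ᴳ-dominant-≡0 n F (separator n K) G) (mk⇔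
  [ here , there ∘ Equivalence.to (separator-≡0 n K G) ]′
  λ { (here hF≡0) → inj₁ hF≡0 ; (there any) → inj₂ (Equivalence.from (separator-≡0 n K G) any) })

separator-cong : ∀ n K G H → ∣V∣ G ≡ ∣V∣ H → All (λ F → hom F G ≡ hom F H) K →
                 hom (separator n K) G ≡ hom (separator n K) H
separator-cong n []      G H ∣G∣≡∣H∣ [] = trans (hom-K₁ G) (trans ∣G∣≡∣H∣ (sym (hom-K₁ H)))
separator-cong n (F ∷ K) G H ∣G∣≡∣H∣ (hF ∷ hK) = begin
  hom (separator n (F ∷ K)) G             ≡⟨ hom-⊎ᴳ-dominant n F (separator n K) G ⟩
  hom F G ^ suc e * hom (separator n K) G ≡⟨ cong₂ (λ h r → h ^ suc e * r) hF (separator-cong n K G H ∣G∣≡∣H∣ hK) ⟩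
  hom F H ^ suc e * hom (separator n K) H ≡⟨ hom-⊎ᴳ-dominant n F (separator n K) H ⟨
  hom (separator n (F ∷ K)) H             ∎
  where
  open ≡-Reasoning
  e : ℕ
  e = exponent n F (separator n K)

separator-injective : ∀ n K G H → ∣V∣ G ≡ n → ∣V∣ H ≡ n → hom (separator n K) G ≢ 0 →
                      hom (separator n K) G ≡ hom (separator n K) H → All (λ F → hom F G ≡ hom F H) K
separator-injective n []      G H _   _   _   _   = []
separator-injective n (F ∷ K) G H ∣G∣ ∣H∣ X≢0 X≡Y =
  proj₁ homs≡ ∷ separator-injective n K G H ∣G∣ ∣H∣ R≢0 (proj₂ homs≡)
  where
  R : Graph
  R = separator n K
  homs≡ : hom F G ≡ hom F H × hom R G ≡ hom R H
  homs≡ = ⊎ᴳ-dominant-injective n F R G H ∣G∣ ∣H∣ X≢0 X≡Y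
  R≢0 : hom R G ≢ 0
  R≢0 = X≢0 ∘ Equivalence.from (⊎ᴳ-dominant-≡0 n F R G) ∘ inj₂

lemma8p5 : (n : ℕ) → n ≥ 1 → (K : List Graph) →
    Σ Graph (λ FK → (G H : Graph) → ∣V∣ G ≡ n → ∣V∣ H ≡ n →
    ((hom FK G ≡ hom FK H) ⇔
    ((Any (λ F → hom F G ≡ 0) K × Any (λ F′ → hom F′ H ≡ 0) K)
    ⊎ All (λ F → hom F G ≡ hom F H) K)))
lemma8p5 n _ K = separator n K , λ G H ∣G∣ ∣H∣ → mk⇔ (classify G H ∣G∣ ∣H∣) (realise G H ∣G∣ ∣H∣)
  where
  Verdict : Graph → Graph → Set
  Verdict G H = (Any (λ F → hom F G ≡ 0) K × Any (λ F′ → hom F′ H ≡ 0) K)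
              ⊎ All (λ F → hom F G ≡ hom F H) K
  classify : ∀ G H → ∣V∣ G ≡ n → ∣V∣ H ≡ n → hom (separator n K) G ≡ hom (separator n K) H → Verdict G H
  classify G H ∣G∣ ∣H∣ X≡Y with hom (separator n K) G ≟ 0
  ... | yes X≡0 = inj₁ ( Equivalence.to (separator-≡0 n K G) X≡0
                       , Equivalence.to (separator-≡0 n K H) (trans (sym X≡Y) X≡0))
  ... | no  X≢0 = inj₂ (separator-injective n K G H ∣G∣ ∣H∣ X≢0 X≡Y)
  realise : ∀ G H → ∣V∣ G ≡ n → ∣V∣ H ≡ n → Verdict G H → hom (separator n K) G ≡ hom (separator n K) H
  realise G H _ _ (inj₁ (G≡0 , H≡0)) =
    trans (Equivalence.from (separator-≡0 n K G) G≡0) (sym (Equivalence.from (separator-≡0 n K H) H≡0))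
  realise G H ∣G∣ ∣H∣ (inj₂ homs≡) = separator-cong n K G H (trans ∣G∣ (sym ∣H∣)) homs≡
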